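{- Let $\mathcal{B}$ be a saturated set and $\mathcal{M}$ a $\mathcal{B}$-model. (1) If $\mathcal{U},\mathcal{V}\in\mathcal{M}$ are $\mathcal{B}$-saturated and $\mathcal{U}\leadsto\mathcal{V}\in\mathcal{M}$, then $\mathcal{U}\leadsto\mathcal{V}$ is $\mathcal{B}$-saturated. (2) Every element of $\mathcal{M}$ is $\mathcal{B}$-saturated.
   Context: $\lambda\mu$-terms: $\mathcal{T} ::= x \mid \lambda x.\mathcal{T} \mid (\mathcal{T})\mathcal{T} \mid [\alpha]\mathcal{T} \mid \mu\alpha.\mathcal{T}$, up to renaming of bound variables; substitutions avoid capture. Types $A ::= X \mid \bot \mid A\to B$; typing judgments $\Gamma\vdash M:A;\Theta$ by: $\Gamma,x:A\vdash x:A;\Theta$; from $\Gamma,x:A\vdash M:B;\Theta$ infer $\Gamma\vdash\lambda x.M:A\to B;\Theta$; from $\Gamma\vdash M:A\to B;\Theta$, $\Gamma\vdash N:A;\Theta$ infer $\Gamma\vdash(M)N:B;\Theta$; from $\Gamma\vdash M:A;\alpha:A,\Theta$ infer $\Gamma\vdash[\alpha]M:\bot;\alpha:A,\Theta$; from $\Gamma\vdash M:\bot;\alpha:A,\Theta$ infer $\Gamma\vdash\mu\alpha.M:A;\Theta$. $\mathcal{T}_t$ = typable terms. $(M)P_1\dots P_k=(\dots((M)P_1)\dots)P_k$, $(M)\varnothing=M$; $\bar P\sqsubseteq\bar N$: initial segment; $\mathcal{L}^{<\omega}$ finite sequences from $\mathcal{L}$. $M[\alpha:=_rN]$ replaces inductively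 each $[\alpha]P$ by $[\alpha](P')N$; $M[\alpha:=_rN_1\dots N_n]=M[\alpha:=_rN_1]\dots[\alpha:=_rN_n]$. Saturated set: $\mathcal{B}\subseteq\mathcal{T}_t$ with (C1) $M\in\mathcal{B}\Rightarrow\lambda x.M\in\mathcal{B}$; (C2) $M\in\mathcal{B}$, $\mu\alpha.M\in\mathcal{T}_t\Rightarrow\mu\alpha.M\in\mathcal{B}$; (C3) $M\in\mathcal{B}$, $[\alpha]M\in\mathcal{T}_t\Rightarrow[\alpha]M\in\mathcal{B}$; (C4) $n\ge0$, $N_i\in\mathcal{B}$, $(x)N_1\dots N_n\in\mathcal{T}_t\Rightarrow(x)N_1\dots N_n\in\mathcal{B}$; (C5) $M,N\in\mathcal{T}_t$, $\bar P\in\mathcal{T}_t^{<\omega}$, $N\in\mathcal{B}$, $(\lambda x.M)N\bar P\in\mathcal{T}_t$, $(M[x:=N])\bar P\in\mathcal{B}\Rightarrow(\lambda x.M)N\bar P\in\mathcal{B}$; (C6) $M\in\mathcal{T}_t$, $\bar N\in\mathcal{B}^{<\omega}$, $(\mu\alpha.M)\bar N\in\mathcal{T}_t$, $\mu\alpha.M[\alpha:=_r\bar N]\in\mathcal{B}\Rightarrow(\mu\alpha.M)\bar N\in\mathcal{B}$. For sets of terms $\mathcal{K},\mathcal{L}\subseteq\mathcal{B}$: $\mathcal{K}\leadsto\mathcal{L}=\{M\in\mathcal{B}\mid\forall N\in\mathcal{K},(M)N\in\mathcal{T}_t\Rightarrow(M)N\in\mathcal{L}\}$; for a set of sequences $\mathcal{X}\subseteq\mathcal{B}^{<\omega}$: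 $\mathcal{X}\leadsto\mathcal{B}=\{M\in\mathcal{B}\mid\forall\bar N\in\mathcal{X},\forall\bar P\sqsubseteq\bar N,(M)\bar P\in\mathcal{T}_t\Rightarrow(M)\bar P\in\mathcal{B}\}$. $\mathcal{S}\subseteq\mathcal{B}$ is $\mathcal{B}$-saturated if (D1) for $M,N\in\mathcal{T}_t$, $\bar P\in\mathcal{T}_t^{<\omega}$ with $N\in\mathcal{B}$, $(\lambda x.M)N\bar P\in\mathcal{T}_t$ and $(M[x:=N])\bar P\in\mathcal{S}$, we get $(\lambda x.M)N\bar P\in\mathcal{S}$; (D2) for $n\ge0$, $N_1,\dots,N_n\in\mathcal{B}$, $(x)N_1\dots N_n\in\mathcal{T}_t$ implies $(x)N_1\dots N_n\in\mathcal{S}$; (D3) $\mathcal{S}=\mathcal{X}_{\mathcal{S}}\leadsto\mathcal{B}$ for some $\mathcal{X}_{\mathcal{S}}\subseteq\mathcal{B}^{<\omega}$. A $\mathcal{B}$-model, given a family $(\mathcal{S}_i)_{i\in I}$ of $\mathcal{B}$-saturated sets, is the smallest set $\mathcal{M}$ containing $\mathcal{B}$ and all $\mathcal{S}_i$ and closed under $(\mathcal{U},\mathcal{V})\mapsto\mathcal{U}\leadsto\mathcal{V}$. -}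

module Defs where

open import Data.Nat using (ℕ; zero; suc; _<ᵇ_; _≡ᵇ_; pred)
open import Data.Bool using (if_then_else_)
open import Data.List using (List; []; _∷_; foldl; map; _++_)
open import Data.List.Relation.Unary.All using (All)
open import Data.Product using (Σ; _×_; ∃)
open import Relation.Binary.PropositionalEquality using (_≡_)

-- λμ-terms, up to α-renaming: locally nameless de Bruijn representation.
-- Two separate namespaces of de Bruijn indices: term variables (x) and
-- μ-variables (α).

data Tm : Set where
  var  : ℕ → Tm
  lam  : Tm → Tm          -- λx.M   (binds term index 0)
  app  : Tm → Tm → Tm
  name : ℕ → Tm → Tm
  mu   : Tm → Tm          -- μα.M   (binds μ-index 0)

shiftT : ℕ → Tm → Tm
shiftT c (var x)    = if x <ᵇ c then var x else var (suc x)
shiftT c (lam M)    = lam (shiftT (suc c) M)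
shiftT c (app M N)  = app (shiftT c M) (shiftT c N)
shiftT c (name a M) = name a (shiftT c M)
shiftT c (mu M)     = mu (shiftT c M)

shiftM : ℕ → Tm → Tm
shiftM c (var x)    = var x
shiftM c (lam M)    = lam (shiftM c M)
shiftM c (app M N)  = app (shiftM c M) (shiftM c N)
shiftM c (name a M) = (if a <ᵇ c then name a else name (suc a)) (shiftM c M)
shiftM c (mu M)     = mu (shiftM (suc c) M)

-- capture-avoiding substitution of N for term variable j (binder removed:
-- free variables above j are decremented).  M[x:=N] for the β-redex
-- (λx.M)N is  subst 0 N M.
subst : ℕ → Tm → Tm → Tm
subst j N (var x)    =
  if x ≡ᵇ j then N else (if x <ᵇ j then var x else var (pred x))
subst j N (lam M)    = lam (subst (suc j) (shiftT 0 N) M)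
subst j N (app M P)  = app (subst j N M) (subst j N P)
subst j N (name a M) = name a (subst j N M)
subst j N (mu M)     = mu (subst j (shiftM 0 N) M)

-- M[α:=_r N] for the μ-variable with index k: each [α]P becomes [α](P')N
-- with P' = P[α:=_r N].
mrep : ℕ → Tm → Tm → Tm
mrep k N (var x)    = var x
mrep k N (lam M)    = lam (mrep k (shiftT 0 N) M)
mrep k N (app M P)  = app (mrep k N M) (mrep k N P)
mrep k N (name a M) =
  if a ≡ᵇ k then name a (app (mrep k N M) N) else name a (mrep k N M)
mrep k N (mu M)     = mu (mrep (suc k) (shiftM 0 N) M)

mrepSeq : ℕ → List Tm → Tm → Tm
mrepSeq k Ns M = foldl (λ P N → mrep k N P) M Ns

apps : Tm → List Tm → Tm
apps = foldl app

_⊑_ : List Tm → List Tm → Set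
Ps ⊑ Ns = ∃ λ Qs → Ps ++ Qs ≡ Ns

-- Types and typing (Curry style; contexts as total assignments of types
-- to de Bruijn indices)

data Ty : Set where
  atom : ℕ → Ty
  ⊥ₜ   : Ty
  _⇒_  : Ty → Ty → Ty

Ctx : Set
Ctx = ℕ → Ty

_,,_ : Ctx → Ty → Ctx
(Γ ,, A) zero    = A
(Γ ,, A) (suc n) = Γ n

data _⊢_∶_∣_ : Ctx → Tm → Ty → Ctx → Set where
  ty-var  : ∀ {Γ Θ x A} → Γ x ≡ A → Γ ⊢ var x ∶ A ∣ Θ
  ty-lam  : ∀ {Γ Θ M A B} → (Γ ,, A) ⊢ M ∶ B ∣ Θ → Γ ⊢ lam M ∶ A ⇒ B ∣ Θ
  ty-app  : ∀ {Γ Θ M N A B} → Γ ⊢ M ∶ A ⇒ B ∣ Θ → Γ ⊢ N ∶ A ∣ Θ →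
            Γ ⊢ app M N ∶ B ∣ Θ
  ty-name : ∀ {Γ Θ M a A} → Θ a ≡ A → Γ ⊢ M ∶ A ∣ Θ → Γ ⊢ name a M ∶ ⊥ₜ ∣ Θ
  ty-mu   : ∀ {Γ Θ M A} → Γ ⊢ M ∶ ⊥ₜ ∣ (Θ ,, A) → Γ ⊢ mu M ∶ A ∣ Θ

Typable : Tm → Set
Typable M = Σ Ctx λ Γ → Σ Ctx λ Θ → Σ Ty λ A → Γ ⊢ M ∶ A ∣ Θ

TmSet : Set₁
TmSet = Tm → Set

_⊆_ : TmSet → TmSet → Set
K ⊆ L = ∀ M → K M → L M

_≐_ : TmSet → TmSet → Set
K ≐ L = (K ⊆ L) × (L ⊆ K)

record IsSaturated (B : TmSet) : Set where
  field
    typable : ∀ M → B M → Typable M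
    C1 : ∀ M → B M → B (lam M)
    C2 : ∀ M → B M → Typable (mu M) → B (mu M)
    C3 : ∀ a M → B M → Typable (name a M) → B (name a M)
    C4 : ∀ x Ns → All B Ns → Typable (apps (var x) Ns) → B (apps (var x) Ns)
    C5 : ∀ M N Ps → Typable M → Typable N → All Typable Ps → B N →
         Typable (apps (app (lam M) N) Ps) →
         B (apps (subst 0 N M) Ps) → B (apps (app (lam M) N) Ps)
    C6 : ∀ M Ns → Typable M → All B Ns → Typable (apps (mu M) Ns) →
         B (mu (mrepSeq 0 (map (shiftM 0) Ns) M)) → B (apps (mu M) Ns)

Arr : TmSet → TmSet → TmSet → TmSet
Arr B K L M = B M × (∀ N → K N → Typable (app M N) → L (app M N))

SeqArr : TmSet → (List Tm → Set) → TmSet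
SeqArr B X M =
  B M × (∀ Ns → X Ns → ∀ Ps → Ps ⊑ Ns → Typable (apps M Ps) → B (apps M Ps))

record IsBSaturated (B S : TmSet) : Set₁ where
  field
    sub : S ⊆ B
    D1  : ∀ M N Ps → Typable M → Typable N → All Typable Ps → B N →
          Typable (apps (app (lam M) N) Ps) →
          S (apps (subst 0 N M) Ps) → S (apps (app (lam M) N) Ps)
    D2  : ∀ x Ns → All B Ns → Typable (apps (var x) Ns) → S (apps (var x) Ns)
    D3  : Σ (List Tm → Set) λ X → (∀ Ns → X Ns → All B Ns) × (S ≐ SeqArr B X)

-- membership in the B-model generated by the family S : I → TmSet:
-- smallest collection containing B and every S i, closed under ⇝
-- (and, sets being extensional, under extensional equality).
data InModel (B : TmSet) {I : Set} (S : I → TmSet) : TmSet → Set₁ where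
  m-base : InModel B S B
  m-fam  : ∀ i → InModel B S (S i)
  m-arr  : ∀ {U V} → InModel B S U → InModel B S V → InModel B S (Arr B U V)
  m-ext  : ∀ {U V} → InModel B S U → U ≐ V → InModel B S V

module Submission where

-- A function set U ⇝ V inherits closure under head β-expansion (D1) and contains the
-- neutral terms (D2) because an extra argument Q ∈ U can be pushed into the spine
-- (M)P̄ of the redex or variable, where V's own closure properties apply; subject
-- reduction provides the typability side conditions.  For (D3), if V = 𝒳 ⇝ B then
-- U ⇝ V = 𝒳′ ⇝ B for the set 𝒳′ of sequences N N̄ with N ∈ U and N̄ empty or in 𝒳.
-- B itself is B-saturated (with 𝒳 = ∅), so induction on the generation of the model
-- gives (2), and (1) holds even without the membership hypotheses.

open import Defs
open import Data.Bool using (true; false; if_then_else_)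
open import Data.Empty using () renaming (⊥ to Empty)
open import Data.List using (List; []; _∷_; _∷ʳ_)
open import Data.List.Properties using (foldl-∷ʳ)
open import Data.List.Relation.Unary.All using (All; []; _∷_)
open import Data.List.Relation.Unary.All.Properties using (∷ʳ⁺)
open import Data.Nat using (ℕ; zero; suc; _<ᵇ_; _≡ᵇ_; pred)
open import Data.Product using (Σ; _×_; _,_; proj₁; proj₂)
open import Data.Sum using (_⊎_; inj₁; inj₂)
open import Relation.Binary.PropositionalEquality
  using (_≡_; refl; sym; trans; cong) renaming (subst to transport)

ShiftsContext : ℕ → Ctx → Ctx → Set
ShiftsContext c Γ Γ′ = ∀ x → Γ′ (if x <ᵇ c then x else suc x) ≡ Γ x

ShiftsContext-,, : ∀ {Γ Γ′ C} c → ShiftsContext c Γ Γ′ →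
                   ShiftsContext (suc c) (Γ ,, C) (Γ′ ,, C)
ShiftsContext-,, c h zero = refl
ShiftsContext-,, c h (suc x) with x <ᵇ c | h x
... | true  | e = e
... | false | e = e

shiftT-typing : ∀ {Γ Γ′ Θ M A} c → ShiftsContext c Γ Γ′ →
                Γ ⊢ M ∶ A ∣ Θ → Γ′ ⊢ shiftT c M ∶ A ∣ Θ
shiftT-typing c h (ty-var {x = x} e) with x <ᵇ c | h x
... | true  | e′ = ty-var (trans e′ e)
... | false | e′ = ty-var (trans e′ e)
shiftT-typing c h (ty-lam d)    = ty-lam (shiftT-typing (suc c) (ShiftsContext-,, c h) d)
shiftT-typing c h (ty-app d e)  = ty-app (shiftT-typing c h d) (shiftT-typing c h e)
shiftT-typing c h (ty-name e d) = ty-name e (shiftT-typing c h d)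
shiftT-typing c h (ty-mu d)     = ty-mu (shiftT-typing c h d)

shiftM-typing : ∀ {Γ Θ Θ′ M A} c → ShiftsContext c Θ Θ′ →
                Γ ⊢ M ∶ A ∣ Θ → Γ ⊢ shiftM c M ∶ A ∣ Θ′
shiftM-typing c h (ty-var e)    = ty-var e
shiftM-typing c h (ty-lam d)    = ty-lam (shiftM-typing c h d)
shiftM-typing c h (ty-app d e)  = ty-app (shiftM-typing c h d) (shiftM-typing c h e)
shiftM-typing c h (ty-name {a = a} e d) with a <ᵇ c | h a
... | true  | e′ = ty-name (trans e′ e) (shiftM-typing c h d)
... | false | e′ = ty-name (trans e′ e) (shiftM-typing c h d)
shiftM-typing c h (ty-mu d)     = ty-mu (shiftM-typing (suc c) (ShiftsContext-,, c h) d)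

InsertsAt : ℕ → Ty → Ctx → Ctx → Set
InsertsAt j A Γ Δ = ∀ x → Δ x ≡ (if x ≡ᵇ j then A else (if x <ᵇ j then Γ x else Γ (pred x)))

InsertsAt-,, : ∀ {Γ Δ A C} j → InsertsAt j A Γ Δ → InsertsAt (suc j) A (Γ ,, C) (Δ ,, C)
InsertsAt-,, j       h zero          = refl
InsertsAt-,, zero    h (suc zero)    = h 0
InsertsAt-,, (suc j) h (suc zero)    = h 0
InsertsAt-,, j       h (suc (suc x)) with suc x ≡ᵇ j | suc x <ᵇ j | h (suc x)
... | true  | _     | e = e
... | false | true  | e = e
... | false | false | e = e

subst-typing : ∀ {Γ Δ Θ M N A B} j → InsertsAt j A Γ Δ →
               Γ ⊢ N ∶ A ∣ Θ → Δ ⊢ M ∶ B ∣ Θ → Γ ⊢ subst j N M ∶ B ∣ Θ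
subst-typing {Γ} {Θ = Θ} {N = N} j h dN (ty-var {x = x} e) with x ≡ᵇ j | x <ᵇ j | h x
... | true  | _     | e′ = transport (λ T → Γ ⊢ N ∶ T ∣ Θ) (trans (sym e′) e) dN
... | false | true  | e′ = ty-var (trans (sym e′) e)
... | false | false | e′ = ty-var (trans (sym e′) e)
subst-typing j h dN (ty-lam d) =
  ty-lam (subst-typing (suc j) (InsertsAt-,, j h) (shiftT-typing 0 (λ _ → refl) dN) d)
subst-typing j h dN (ty-app d e)  = ty-app (subst-typing j h dN d) (subst-typing j h dN e)
subst-typing j h dN (ty-name e d) = ty-name e (subst-typing j h dN d)
subst-typing j h dN (ty-mu d)     = ty-mu (subst-typing j h (shiftM-typing 0 (λ _ → refl) dN) d)

β-typing : ∀ {Γ Θ M N A} → Γ ⊢ app (lam M) N ∶ A ∣ Θ → Γ ⊢ subst 0 N M ∶ A ∣ Θ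
β-typing (ty-app (ty-lam d) e) = subst-typing 0 (λ { zero → refl ; (suc _) → refl }) e d

apps-typing-head : ∀ {M M′} → (∀ {Γ Θ A} → Γ ⊢ M ∶ A ∣ Θ → Γ ⊢ M′ ∶ A ∣ Θ) →
                   ∀ Ps {Γ Θ A} → Γ ⊢ apps M Ps ∶ A ∣ Θ → Γ ⊢ apps M′ Ps ∶ A ∣ Θ
apps-typing-head f []       d = f d
apps-typing-head f (P ∷ Ps) d =
  apps-typing-head (λ { (ty-app dM dP) → ty-app (f dM) dP }) Ps d

apps-typable-head : ∀ M Ps → Typable (apps M Ps) → Typable M
apps-typable-head M []       t = t
apps-typable-head M (P ∷ Ps) t with apps-typable-head (app M P) Ps t
... | Γ , Θ , _ , ty-app d _ = Γ , Θ , _ , d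

apps-∷ʳ⁻ : ∀ (X : TmSet) M Ps Q → X (apps M (Ps ∷ʳ Q)) → X (app (apps M Ps) Q)
apps-∷ʳ⁻ X M Ps Q = transport X (foldl-∷ʳ app M Q Ps)

apps-∷ʳ⁺ : ∀ (X : TmSet) M Ps Q → X (app (apps M Ps) Q) → X (apps M (Ps ∷ʳ Q))
apps-∷ʳ⁺ X M Ps Q = transport X (sym (foldl-∷ʳ app M Q Ps))

module _ (B : TmSet) (sat : IsSaturated B) where
  open IsSaturated sat

  B-isBSaturated : IsBSaturated B B
  B-isBSaturated = record
    { sub = λ _ b → b
    ; D1  = C5
    ; D2  = C4
    ; D3  = (λ _ → Empty) , (λ _ ()) , (λ _ b → b , λ _ ()) , (λ _ → proj₁)
    }

  IsBSaturated-resp-≐ : ∀ {U V} → U ≐ V → IsBSaturated B U → IsBSaturated B V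
  IsBSaturated-resp-≐ (U⊆V , V⊆U) su = record
    { sub = λ M v → sub M (V⊆U M v)
    ; D1  = λ M N Ps tM tN tPs bN t v → U⊆V _ (D1 M N Ps tM tN tPs bN t (V⊆U _ v))
    ; D2  = λ x Ns bNs t → U⊆V _ (D2 x Ns bNs t)
    ; D3  = let (X , X⊆B , U⊆X⇝B , X⇝B⊆U) = D3
            in X , X⊆B , (λ M v → U⊆X⇝B M (V⊆U M v)) , (λ M s → U⊆V M (X⇝B⊆U M s))
    }
    where open IsBSaturated su

  module _ (U V : TmSet) (su : IsBSaturated B U) (sv : IsBSaturated B V) where
    private
      module SU = IsBSaturated su
      module SV = IsBSaturated sv
      XV = proj₁ SV.D3
      XV⊆B = proj₁ (proj₂ SV.D3)
      V⊆XV⇝B = proj₁ (proj₂ (proj₂ SV.D3))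
      XV⇝B⊆V = proj₂ (proj₂ (proj₂ SV.D3))

    Arr-D1 : ∀ M N Ps → Typable M → Typable N → All Typable Ps → B N →
             Typable (apps (app (lam M) N) Ps) →
             Arr B U V (apps (subst 0 N M) Ps) → Arr B U V (apps (app (lam M) N) Ps)
    Arr-D1 M N Ps tM tN tPs bN t (bR , fR) = C5 M N Ps tM tN tPs bN t bR , V-extends
      where
      R = app (lam M) N
      V-extends : ∀ Q → U Q → Typable (app (apps R Ps) Q) → V (app (apps R Ps) Q)
      V-extends Q uQ (Γ , Θ , A , ty-app d e) =
        apps-∷ʳ⁻ V R Ps Q
          (SV.D1 M N (Ps ∷ʳ Q) tM tN (∷ʳ⁺ tPs (typable Q (SU.sub Q uQ))) bN
            (apps-∷ʳ⁺ Typable R Ps Q (Γ , Θ , A , ty-app d e))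
            (apps-∷ʳ⁺ V (subst 0 N M) Ps Q
              (fR Q uQ (Γ , Θ , A , ty-app (apps-typing-head β-typing Ps d) e))))

    Arr-D2 : ∀ x Ns → All B Ns → Typable (apps (var x) Ns) → Arr B U V (apps (var x) Ns)
    Arr-D2 x Ns bNs t = C4 x Ns bNs t , λ Q uQ tQ →
      apps-∷ʳ⁻ V (var x) Ns Q
        (SV.D2 x (Ns ∷ʳ Q) (∷ʳ⁺ bNs (SU.sub Q uQ)) (apps-∷ʳ⁺ Typable (var x) Ns Q tQ))

    ArrSeqs : List Tm → Set
    ArrSeqs Ls = Σ Tm λ N → Σ (List Tm) λ Ns → Ls ≡ N ∷ Ns × U N × (Ns ≡ [] ⊎ XV Ns)

    ArrSeqs⊆B : ∀ Ls → ArrSeqs Ls → All B Ls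
    ArrSeqs⊆B _ (N , _  , refl , uN , inj₁ refl) = SU.sub N uN ∷ []
    ArrSeqs⊆B _ (N , Ns , refl , uN , inj₂ xs)   = SU.sub N uN ∷ XV⊆B Ns xs

    Arr⊆ArrSeqs⇝B : Arr B U V ⊆ SeqArr B ArrSeqs
    Arr⊆ArrSeqs⇝B M (bM , f) = bM , prefixes
      where
      prefixes : ∀ Ls → ArrSeqs Ls → ∀ Ps → Ps ⊑ Ls → Typable (apps M Ps) → B (apps M Ps)
      prefixes _ _ [] _ _ = bM
      prefixes _ (N , _ , refl , uN , inj₁ refl) (_ ∷ []) (_ , refl) t =
        SV.sub _ (f N uN t)
      prefixes _ (N , _ , refl , uN , inj₂ xs) (_ ∷ Ps) (Qs , refl) t =
        proj₂ (V⊆XV⇝B _ (f N uN (apps-typable-head (app M N) Ps t))) _ xs Ps (Qs , refl) t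

    ArrSeqs⇝B⊆Arr : SeqArr B ArrSeqs ⊆ Arr B U V
    ArrSeqs⇝B⊆Arr M (bM , prefixes) = bM , λ N uN t →
      XV⇝B⊆V _
        ( prefixes (N ∷ []) (N , [] , refl , uN , inj₁ refl) (N ∷ []) ([] , refl) t
        , λ Ns xs Ps (Qs , Ps++Qs≡Ns) t′ →
            prefixes (N ∷ Ns) (N , Ns , refl , uN , inj₂ xs) (N ∷ Ps)
                     (Qs , cong (N ∷_) Ps++Qs≡Ns) t′ )

    Arr-isBSaturated : IsBSaturated B (Arr B U V)
    Arr-isBSaturated = record
      { sub = λ _ → proj₁
      ; D1  = Arr-D1
      ; D2  = Arr-D2
      ; D3  = ArrSeqs , ArrSeqs⊆B , Arr⊆ArrSeqs⇝B , ArrSeqs⇝B⊆Arr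
      }

  InModel⇒IsBSaturated : ∀ {I : Set} (S : I → TmSet) → (∀ i → IsBSaturated B (S i)) →
                         ∀ U → InModel B S U → IsBSaturated B U
  InModel⇒IsBSaturated S sS _ m-base     = B-isBSaturated
  InModel⇒IsBSaturated S sS _ (m-fam i)  = sS i
  InModel⇒IsBSaturated S sS _ (m-arr {U} {V} u v) =
    Arr-isBSaturated U V (InModel⇒IsBSaturated S sS U u) (InModel⇒IsBSaturated S sS V v)
  InModel⇒IsBSaturated S sS _ (m-ext {U} u U≐V) =
    IsBSaturated-resp-≐ U≐V (InModel⇒IsBSaturated S sS U u)

lemma3p10 : (B : TmSet) → IsSaturated B →
            (I : Set) (S : I → TmSet) → (∀ i → IsBSaturated B (S i)) →
            ((U V : TmSet) → InModel B S U → InModel B S V →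
               IsBSaturated B U → IsBSaturated B V →
               InModel B S (Arr B U V) → IsBSaturated B (Arr B U V))
            × ((U : TmSet) → InModel B S U → IsBSaturated B U)
lemma3p10 B sat I S sS =
  (λ U V _ _ su sv _ → Arr-isBSaturated B sat U V su sv) , InModel⇒IsBSaturated B sat S sS
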